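{- Let $(x,y,z,m,n)$ be a nontrivial solution in positive integers with $x>y$ of $\phi\left(z\frac{x^m-y^m}{x-y}\right)=z\frac{x^n-y^n}{x-y}$ such that $1\le z\le x-y$ and $\gcd(m,n)=1$. Then $$x<\prod_{p\mid z(x^m-y^m)/(x-y)}\left(1+\frac1{p-1}\right),$$ where the product runs over the primes $p$ dividing $z(x^m-y^m)/(x-y)$.
   Context: $\phi$ is Euler's totient function. A solution $(x,y,z,m,n)$ of this equation in positive integers with $x>y$ is trivial if it equals $(a,b,1,1,1)$ for integers $a>b\ge1$; otherwise nontrivial. -}

module Defs where

open import Data.Nat using (ℕ; zero; suc; _+_; _*_; _∸_; _^_; _≟_)
open import Data.Nat.DivMod using (_/_)
open import Data.Nat.GCD using (gcd)
open import Data.Nat.Divisibility using (_∣?_)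
open import Data.Nat.Primality using (prime?)
open import Data.List using (List; length; filter; upTo; map; foldr)
open import Data.Integer using (+_)
open import Data.Rational using (ℚ; 1ℚ) renaming (_+_ to _+ℚ_; _*_ to _*ℚ_; _/_ to _/ℚ_)

φ : ℕ → ℕ
φ N = length (filter (λ k → gcd k N ≟ 1) (map suc (upTo N)))

-- (x^m - y^m)/(x - y) as exact natural-number division (x > y in all uses;
-- returns 0 when x ≤ y, a case never used).
quot : ℕ → ℕ → ℕ → ℕ
quot x y m with x ∸ y
... | zero  = 0
... | suc d = (x ^ m ∸ y ^ m) / suc d

primeDivisors : ℕ → List ℕ
primeDivisors N = filter (λ p → p ∣? N) (filter prime? (map suc (upTo N)))

factor : ℕ → ℚ
factor (suc (suc k)) = 1ℚ +ℚ ((+ 1) /ℚ suc k)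
factor _ = 1ℚ

primeProd : ℕ → ℚ
primeProd N = foldr (λ p acc → factor p *ℚ acc) 1ℚ (primeDivisors N)

{-# OPTIONS --safe #-}
-- Euler's product formula, in the integral form φ N · ∏ p = N · ∏ (p − 1) over the primes
-- p ∣ N, turns the equation into U n · ∏ p = U m · ∏ (p − 1) with U k = (x^k − y^k)/(x − y).
-- A nontrivial solution has N = z · U m ≥ 2, so ∏ (p − 1) < ∏ p, which forces n < m; then
-- x · U n < U (n + 1) ≤ U m yields x · ∏ (p − 1) < ∏ p, i.e. x < ∏ p/(p − 1).
-- The product formula is proved by sieving: among 1, …, c · ∏ p, discarding the multiples
-- of one prime at a time leaves exactly c · ∏ (p − 1) numbers.

module Submission where

open import Defs
open import Data.Nat using (ℕ; zero; suc; pred; _+_; _*_; _∸_; _^_; _<_; _≤_; _>_; z≤n; s≤s; NonZero; >-nonZero; ≢-nonZero⁻¹)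
open import Data.Nat.Properties
open import Data.Nat.DivMod using (m*n/n≡m) renaming (_/_ to _div_)
open import Data.Nat.Divisibility using (_∣_; _∣?_; divides; ∣-refl; ∣-trans; ∣⇒≤; ∣1⇒≡1; ∣n⇒∣m*n; ∣m+n∣m⇒∣n; ∣m∣n⇒∣m+n)
open import Data.Nat.GCD using (gcd; gcd-greatest; gcd[m,n]∣m; gcd[m,n]∣n; gcd[m,n]≡0⇒n≡0)
open import Data.Nat.Primality using (Prime; prime?; euclidsLemma; prime⇒irreducible; prime⇒nonZero; ¬prime[0]; ¬prime[1]; productOfPrimes≥1)
open import Data.Nat.Primality.Factorisation using (factorise; factorisationHasAllPrimeFactors)
open import Data.Nat.ListAction using (product)
open import Data.Nat.Tactic.RingSolver using (solve-∀)
open import Data.Bool using (true; false; if_then_else_)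
open import Data.List using (List; []; _∷_; map; foldr; filter; length; upTo; applyUpTo)
open import Data.List.Properties using (map-applyUpTo)
open import Data.List.Relation.Unary.All as All using (All; []; _∷_)
import Data.List.Relation.Unary.All.Properties as All
open import Data.List.Relation.Unary.Any using (here; there)
open import Data.List.Relation.Unary.AllPairs using ([]; _∷_)
open import Data.List.Relation.Unary.Unique.Propositional using (Unique)
import Data.List.Relation.Unary.Unique.Propositional.Properties as Unique
open import Data.List.Membership.Propositional using (_∈_)
open import Data.List.Membership.Propositional.Properties using (∈-filter⁺; ∈-filter⁻; ∈-map⁺; ∈-upTo⁺)
open import Data.Product using (∃-syntax; ∃₂; _×_; _,_; proj₁; proj₂)
open import Data.Sum using (inj₁; inj₂)
open import Data.Integer using (+_)
import Data.Integer as ℤ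
import Data.Integer.Properties as ℤ
open import Data.Rational using (ℚ; 1ℚ; toℚᵘ; _/_) renaming (_<_ to _<ℚ_; _*_ to _*ℚ_)
import Data.Rational.Properties as ℚ
open import Data.Rational.Unnormalised as ℚᵘ using (mkℚᵘ; *≡*; *<*) renaming (_≃_ to _≃ᵘ_)
import Data.Rational.Unnormalised.Properties as ℚᵘ
open import Function using (_∘_)
open import Relation.Nullary using (¬_; Dec; does; yes; no; contradiction)
open import Relation.Nullary.Decidable using (dec-true; dec-false)
open import Relation.Unary using (Decidable)
open import Relation.Binary.PropositionalEquality

-- ∑ n f = f 0 + ⋯ + f (n − 1); a sum over 1, …, N is written ∑ N (f ∘ suc).
∑ : ℕ → (ℕ → ℕ) → ℕ
∑ zero    f = 0
∑ (suc n) f = f 0 + ∑ n (f ∘ suc)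

∑-cong : ∀ n {f g : ℕ → ℕ} → (∀ i → f i ≡ g i) → ∑ n f ≡ ∑ n g
∑-cong zero    f≗g = refl
∑-cong (suc n) f≗g = cong₂ _+_ (f≗g 0) (∑-cong n (f≗g ∘ suc))

∑-+ : ∀ n (f g : ℕ → ℕ) → ∑ n (λ i → f i + g i) ≡ ∑ n f + ∑ n g
∑-+ zero    f g = refl
∑-+ (suc n) f g = begin
  f 0 + g 0 + ∑ n (λ i → f (suc i) + g (suc i))
    ≡⟨ cong (_+_ (f 0 + g 0)) (∑-+ n (f ∘ suc) (g ∘ suc)) ⟩
  f 0 + g 0 + (∑ n (f ∘ suc) + ∑ n (g ∘ suc))
    ≡⟨ +-interchange (f 0) (g 0) _ _ ⟩
  f 0 + ∑ n (f ∘ suc) + (g 0 + ∑ n (g ∘ suc)) ∎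
  where
  open ≡-Reasoning
  +-interchange : ∀ a b c d → a + b + (c + d) ≡ a + c + (b + d)
  +-interchange = solve-∀

∑-+-split : ∀ m n (f : ℕ → ℕ) → ∑ (m + n) f ≡ ∑ m f + ∑ n (f ∘ (_+_ m))
∑-+-split zero    n f = refl
∑-+-split (suc m) n f =
  trans (cong (_+_ (f 0)) (∑-+-split m n (f ∘ suc))) (sym (+-assoc (f 0) _ _))

∑-vanishes : ∀ n (f : ℕ → ℕ) → (∀ i → i < n → f i ≡ 0) → ∑ n f ≡ 0
∑-vanishes zero    f f≡0 = refl
∑-vanishes (suc n) f f≡0 =
  cong₂ _+_ (f≡0 0 (s≤s z≤n)) (∑-vanishes n (f ∘ suc) (λ i i<n → f≡0 (suc i) (s≤s i<n)))

∑-1 : ∀ n → ∑ n (λ _ → 1) ≡ n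
∑-1 zero    = refl
∑-1 (suc n) = cong suc (∑-1 n)

𝟙 : ∀ {a} {A : Set a} → Dec A → ℕ
𝟙 a? = if does a? then 1 else 0

𝟙-yes : ∀ {a} {A : Set a} (a? : Dec A) → A → 𝟙 a? ≡ 1
𝟙-yes a? a rewrite dec-true a? a = refl

𝟙-no : ∀ {a} {A : Set a} (a? : Dec A) → ¬ A → 𝟙 a? ≡ 0
𝟙-no a? ¬a rewrite dec-false a? ¬a = refl

𝟙-cong : ∀ {a b} {A : Set a} {B : Set b} (a? : Dec A) (b? : Dec B) →
  (A → B) → (B → A) → 𝟙 a? ≡ 𝟙 b?
𝟙-cong (yes a) b? A→B B→A = sym (𝟙-yes b? (A→B a))
𝟙-cong (no ¬a) b? A→B B→A = sym (𝟙-no b? (¬a ∘ B→A))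

∑-multiples : ∀ p .{{_ : NonZero p}} M (f : ℕ → ℕ) →
  ∑ (p * M) (λ i → 𝟙 (p ∣? suc i) * f (suc i)) ≡ ∑ M (λ j → f (p * suc j))
∑-multiples p       zero    f = cong (λ t → ∑ t (λ i → 𝟙 (p ∣? suc i) * f (suc i))) (*-zeroʳ p)
∑-multiples p@(suc p′) (suc M) f = begin
  ∑ (p * suc M) g                            ≡⟨ cong (λ t → ∑ t g) (*-suc p M) ⟩
  ∑ (p + p * M) g                            ≡⟨ ∑-+-split p (p * M) g ⟩
  ∑ p g + ∑ (p * M) (g ∘ (_+_ p))            ≡⟨ cong₂ _+_ first-block shifted ⟩
  f (p * 1) + ∑ M (λ j → f (p + p * suc j))  ≡⟨ cong (_+_ (f (p * 1))) (∑-cong M (cong f ∘ p+p*[1+j]≡p*[2+j])) ⟩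
  ∑ (suc M) (λ j → f (p * suc j))            ∎
  where
  open ≡-Reasoning
  g : ℕ → ℕ
  g i = 𝟙 (p ∣? suc i) * f (suc i)
  p+p*[1+j]≡p*[2+j] : ∀ j → p + p * suc j ≡ p * suc (suc j)
  p+p*[1+j]≡p*[2+j] j = sym (*-suc p (suc j))
  p∤ : ∀ i → i < p′ → g i ≡ 0
  p∤ i i<p′ = cong (_* f (suc i)) (𝟙-no (p ∣? suc i) (λ p∣ → <⇒≱ (s≤s i<p′) (∣⇒≤ p∣)))
  first-block : ∑ p g ≡ f (p * 1)
  first-block = begin
    ∑ p g                      ≡⟨ cong (λ t → ∑ t g) (+-comm 1 p′) ⟩
    ∑ (p′ + 1) g               ≡⟨ ∑-+-split p′ 1 g ⟩
    ∑ p′ g + (g (p′ + 0) + 0)  ≡⟨ cong₂ _+_ (∑-vanishes p′ g p∤) (+-identityʳ _) ⟩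
    g (p′ + 0)                 ≡⟨ cong g (+-identityʳ p′) ⟩
    𝟙 (p ∣? p) * f p           ≡⟨ cong (_* f p) (𝟙-yes (p ∣? p) ∣-refl) ⟩
    f p + 0                    ≡⟨ +-identityʳ _ ⟩
    f p                        ≡⟨ cong f (sym (*-identityʳ p)) ⟩
    f (p * 1)                  ∎
  shift-∣ : ∀ k → 𝟙 (p ∣? (p + k)) ≡ 𝟙 (p ∣? k)
  shift-∣ k = 𝟙-cong (p ∣? (p + k)) (p ∣? k) (λ p∣p+k → ∣m+n∣m⇒∣n p∣p+k ∣-refl) (∣m∣n⇒∣m+n ∣-refl)
  g-shift : ∀ i → g (p + i) ≡ 𝟙 (p ∣? suc i) * f (p + suc i)
  g-shift i rewrite sym (+-suc p i) = cong (_* f (p + suc i)) (shift-∣ (suc i))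
  shifted : ∑ (p * M) (g ∘ (_+_ p)) ≡ ∑ M (λ j → f (p + p * suc j))
  shifted = begin
    ∑ (p * M) (g ∘ (_+_ p))
      ≡⟨ ∑-cong (p * M) g-shift ⟩
    ∑ (p * M) (λ i → 𝟙 (p ∣? suc i) * f (p + suc i))
      ≡⟨ ∑-multiples p M (f ∘ (_+_ p)) ⟩
    ∑ M (λ j → f (p + p * suc j)) ∎

-- Legendre's sieve

sieve : List ℕ → ℕ → ℕ
sieve []      k = 1
sieve (p ∷ S) k = if does (p ∣? k) then 0 else sieve S k

sieve-∷ : ∀ p S k → sieve S k ≡ sieve (p ∷ S) k + 𝟙 (p ∣? k) * sieve S k
sieve-∷ p S k with does (p ∣? k)
... | true  = sym (+-identityʳ (sieve S k))
... | false = sym (+-identityʳ (sieve S k))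

sieve-∈ : ∀ {q S k} → q ∈ S → q ∣ k → sieve S k ≡ 0
sieve-∈ {q} {p ∷ S} {k} q∈S q∣k with p ∣? k | q∈S
... | yes _  | _          = refl
... | no p∤k | here refl  = contradiction q∣k p∤k
... | no _   | there q∈S′ = sieve-∈ q∈S′ q∣k

sieve-∤ : ∀ {S k} → All (λ q → ¬ q ∣ k) S → sieve S k ≡ 1
sieve-∤ []                   = refl
sieve-∤ {p ∷ S} {k} (p∤k ∷ S∤k) with p ∣? k
... | yes p∣k = contradiction p∣k p∤k
... | no  _   = sieve-∤ S∤k

prime∣prime⇒≡ : ∀ {p q} → Prime p → Prime q → q ∣ p → q ≡ p
prime∣prime⇒≡ p-prime q-prime q∣p with prime⇒irreducible p-prime q∣p
... | inj₁ refl = contradiction q-prime ¬prime[1]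
... | inj₂ q≡p  = q≡p

sieve-*-prime : ∀ {p S} k → Prime p → All Prime S → All (p ≢_) S →
  sieve S (p * k) ≡ sieve S k
sieve-*-prime k p-prime [] [] = refl
sieve-*-prime {p} {q ∷ S} k p-prime (q-prime ∷ S-prime) (p≢q ∷ p∉S) with q ∣? (p * k) | q ∣? k
... | yes _   | yes _   = refl
... | no _    | no _    = sieve-*-prime k p-prime S-prime p∉S
... | no q∤pk | yes q∣k = contradiction (∣n⇒∣m*n p q∣k) q∤pk
... | yes q∣pk | no q∤k with euclidsLemma p k q-prime q∣pk
...   | inj₁ q∣p = contradiction (sym (prime∣prime⇒≡ p-prime q-prime q∣p)) p≢q
...   | inj₂ q∣k = contradiction q∣k q∤k

-- The multiples p · j of p sieved by S are counted by the same sum up to N / p, since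
-- multiplying by p does not change divisibility by the other primes of S.
sieve-count : ∀ {S} c → All Prime S → Unique S →
  ∑ (product S * c) (sieve S ∘ suc) ≡ c * product (map pred S)
sieve-count {[]} c [] [] = begin
  ∑ (1 * c) (λ _ → 1) ≡⟨ ∑-1 (1 * c) ⟩
  1 * c               ≡⟨ *-comm 1 c ⟩
  c * 1               ∎
  where open ≡-Reasoning
sieve-count {zero ∷ S} c (0-prime ∷ _) _ = contradiction 0-prime ¬prime[0]
sieve-count {p@(suc p′) ∷ S} c (p-prime ∷ S-prime) (p∉S ∷ S-unique) = +-cancelʳ-≡ _ _ _ (begin
  ∑ N (sieve (p ∷ S) ∘ suc) + c * D
    ≡⟨ cong (_+_ (∑ N (sieve (p ∷ S) ∘ suc))) (sym multiples) ⟩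
  ∑ N (sieve (p ∷ S) ∘ suc) + ∑ N sieve-on-multiples
    ≡⟨ sym (∑-+ N _ _) ⟩
  ∑ N (λ i → sieve (p ∷ S) (suc i) + sieve-on-multiples i)
    ≡⟨ ∑-cong N (sym ∘ sieve-∷ p S ∘ suc) ⟩
  ∑ N (sieve S ∘ suc)
    ≡⟨ cong (λ t → ∑ t (sieve S ∘ suc)) (reassoc p M c) ⟩
  ∑ (M * (p * c)) (sieve S ∘ suc)
    ≡⟨ sieve-count (p * c) S-prime S-unique ⟩
  p * c * D
    ≡⟨ suc-*-split p′ c D ⟩
  c * (p′ * D) + c * D ∎)
  where
  open ≡-Reasoning
  M : ℕ
  M = product S
  D : ℕ
  D = product (map pred S)
  N : ℕ
  N = p * M * c
  reassoc : ∀ p M c → p * M * c ≡ M * (p * c)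
  reassoc = solve-∀
  suc-*-split : ∀ p′ c D → suc p′ * c * D ≡ c * (p′ * D) + c * D
  suc-*-split = solve-∀
  sieve-on-multiples : ℕ → ℕ
  sieve-on-multiples i = 𝟙 (p ∣? suc i) * sieve S (suc i)
  multiples : ∑ N sieve-on-multiples ≡ c * D
  multiples = begin
    ∑ N sieve-on-multiples                 ≡⟨ cong (λ t → ∑ t sieve-on-multiples) (*-assoc p M c) ⟩
    ∑ (p * (M * c)) sieve-on-multiples     ≡⟨ ∑-multiples p (M * c) (sieve S) ⟩
    ∑ (M * c) (λ j → sieve S (p * suc j))  ≡⟨ ∑-cong (M * c) (λ j → sieve-*-prime (suc j) p-prime S-prime p∉S) ⟩
    ∑ (M * c) (sieve S ∘ suc)              ≡⟨ sieve-count c S-prime S-unique ⟩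
    c * D                                  ∎

-- Euler's product formula

∃-prime-divisor : ∀ {n} → 1 < n → ∃[ p ] Prime p × p ∣ n
∃-prime-divisor {n} 1<n with factorise n {{>-nonZero (<-trans (s≤s z≤n) 1<n)}}
... | record { factors = []     ; isFactorisation = n≡1 } = contradiction n≡1 (>⇒≢ 1<n)
... | record { factors = p ∷ ps ; isFactorisation = n≡p*ps ; factorsPrime = p-prime ∷ _ } =
  p , p-prime , divides (product ps) (trans n≡p*ps (*-comm p (product ps)))

∈-primeDivisors⁻ : ∀ {N q} → q ∈ primeDivisors N → Prime q × q ∣ N
∈-primeDivisors⁻ {N} q∈ with ∈-filter⁻ (_∣? N) {xs = filter prime? (map suc (upTo N))} q∈
... | q∈primes , q∣N = proj₂ (∈-filter⁻ prime? {xs = map suc (upTo N)} q∈primes) , q∣N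

∈-primeDivisors⁺ : ∀ {N q} .{{_ : NonZero N}} → Prime q → q ∣ N → q ∈ primeDivisors N
∈-primeDivisors⁺ {N} {zero}   q-prime q∣N = contradiction q-prime ¬prime[0]
∈-primeDivisors⁺ {N} {suc q} q-prime q∣N =
  ∈-filter⁺ (_∣? N) (∈-filter⁺ prime? (∈-map⁺ suc (∈-upTo⁺ (∣⇒≤ q∣N))) q-prime) q∣N

primeDivisors-prime : ∀ N → All Prime (primeDivisors N)
primeDivisors-prime N = All.filter⁺ (_∣? N) (All.all-filter prime? (map suc (upTo N)))

primeDivisors-unique : ∀ N → Unique (primeDivisors N)
primeDivisors-unique N =
  Unique.filter⁺ (_∣? N) (Unique.filter⁺ prime? (Unique.map⁺ suc-injective (Unique.upTo⁺ N)))

primeDivisors-∣ : ∀ N → All (_∣ N) (primeDivisors N)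
primeDivisors-∣ N = All.tabulate (proj₂ ∘ ∈-primeDivisors⁻)

product-∣ : ∀ {S n} → All Prime S → Unique S → All (_∣ n) S → product S ∣ n
product-∣ {[]}    {n} [] [] [] = divides n (sym (*-identityʳ n))
product-∣ {p ∷ S} {n} (p-prime ∷ S-prime) (p∉S ∷ S-unique) (p∣n ∷ S∣n)
  with product-∣ S-prime S-unique S∣n
... | divides q n≡q*P with euclidsLemma q (product S) p-prime (subst (p ∣_) n≡q*P p∣n)
...   | inj₂ p∣P =
  contradiction refl (All.lookup p∉S (factorisationHasAllPrimeFactors p-prime p∣P S-prime))
...   | inj₁ (divides r q≡r*p) = divides r (begin
  n                   ≡⟨ n≡q*P ⟩
  q * product S       ≡⟨ cong (_* product S) q≡r*p ⟩
  r * p * product S   ≡⟨ *-assoc r p (product S) ⟩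
  r * (p * product S) ∎)
  where open ≡-Reasoning

coprime⇔sieve : ∀ N .{{_ : NonZero N}} k → 𝟙 (gcd k N ≟ 1) ≡ sieve (primeDivisors N) k
coprime⇔sieve N k with gcd k N in g≡
... | 0           = contradiction (gcd[m,n]≡0⇒n≡0 k g≡) (≢-nonZero⁻¹ N)
... | 1           = sym (sieve-∤ (All.tabulate q∤k))
  where
  q∤k : ∀ {q} → q ∈ primeDivisors N → ¬ q ∣ k
  q∤k q∈ q∣k with ∈-primeDivisors⁻ {N} q∈
  ... | q-prime , q∣N = ¬prime[1] (subst Prime (∣1⇒≡1 (subst (_ ∣_) g≡ (gcd-greatest q∣k q∣N))) q-prime)
... | suc (suc g) with ∃-prime-divisor {gcd k N} (subst (1 <_) (sym g≡) (s≤s (s≤s z≤n)))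
...   | q , q-prime , q∣gcd =
  sym (sieve-∈ (∈-primeDivisors⁺ q-prime (∣-trans q∣gcd (gcd[m,n]∣n k N))) (∣-trans q∣gcd (gcd[m,n]∣m k N)))

length-filter-applyUpTo : ∀ {p} {P : ℕ → Set p} (P? : Decidable P) (f : ℕ → ℕ) n →
  length (filter P? (applyUpTo f n)) ≡ ∑ n (λ i → 𝟙 (P? (f i)))
length-filter-applyUpTo P? f zero = refl
length-filter-applyUpTo P? f (suc n) with does (P? (f 0))
... | true  = cong suc (length-filter-applyUpTo P? (f ∘ suc) n)
... | false = length-filter-applyUpTo P? (f ∘ suc) n

φ≡∑sieve : ∀ N .{{_ : NonZero N}} → φ N ≡ ∑ N (sieve (primeDivisors N) ∘ suc)
φ≡∑sieve N = begin
  length (filter coprime? (map suc (upTo N)))  ≡⟨ cong (length ∘ filter coprime?) (map-applyUpTo (λ i → i) suc N) ⟩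
  length (filter coprime? (applyUpTo suc N))   ≡⟨ length-filter-applyUpTo coprime? suc N ⟩
  ∑ N (λ i → 𝟙 (coprime? (suc i)))             ≡⟨ ∑-cong N (coprime⇔sieve N ∘ suc) ⟩
  ∑ N (sieve (primeDivisors N) ∘ suc)          ∎
  where
  open ≡-Reasoning
  coprime? : ∀ k → Dec (gcd k N ≡ 1)
  coprime? k = gcd k N ≟ 1

φ*∏p≡N*∏[p-1] : ∀ N .{{_ : NonZero N}} →
  φ N * product (primeDivisors N) ≡ N * product (map pred (primeDivisors N))
φ*∏p≡N*∏[p-1] N with product-∣ (primeDivisors-prime N) (primeDivisors-unique N) (primeDivisors-∣ N)
... | divides c N≡c*P = begin
  φ N * P                        ≡⟨ cong (_* P) (φ≡∑sieve N) ⟩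
  ∑ N (sieve S ∘ suc) * P        ≡⟨ cong (λ t → ∑ t (sieve S ∘ suc) * P) (trans N≡c*P (*-comm c P)) ⟩
  ∑ (P * c) (sieve S ∘ suc) * P  ≡⟨ cong (_* P) (sieve-count c (primeDivisors-prime N) (primeDivisors-unique N)) ⟩
  c * D * P                      ≡⟨ *-comm-middle c D P ⟩
  c * P * D                      ≡⟨ cong (_* D) (sym N≡c*P) ⟩
  N * D                          ∎
  where
  open ≡-Reasoning
  S : List ℕ
  S = primeDivisors N
  P : ℕ
  P = product S
  D : ℕ
  D = product (map pred S)
  *-comm-middle : ∀ a b c → a * b * c ≡ a * c * b
  *-comm-middle = solve-∀

φ[z*a]≡z*b⇒b*∏p≡a*∏[p-1] : ∀ z a b .{{_ : NonZero z}} .{{_ : NonZero a}} →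
  φ (z * a) ≡ z * b →
  b * product (primeDivisors (z * a)) ≡ a * product (map pred (primeDivisors (z * a)))
φ[z*a]≡z*b⇒b*∏p≡a*∏[p-1] z a b φ≡ = *-cancelˡ-≡ _ _ z (begin
  z * (b * P)   ≡⟨ *-assoc z b P ⟨
  z * b * P     ≡⟨ cong (_* P) φ≡ ⟨
  φ (z * a) * P ≡⟨ φ*∏p≡N*∏[p-1] (z * a) {{m*n≢0 z a}} ⟩
  z * a * D     ≡⟨ *-assoc z a D ⟩
  z * (a * D)   ∎)
  where
  open ≡-Reasoning
  P : ℕ
  P = product (primeDivisors (z * a))
  D : ℕ
  D = product (map pred (primeDivisors (z * a)))

∏pred≤∏ : ∀ S → product (map pred S) ≤ product S
∏pred≤∏ []      = ≤-refl
∏pred≤∏ (p ∷ S) = *-mono-≤ (pred[n]≤n {p}) (∏pred≤∏ S)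

∏pred<∏ : ∀ {S q} → All Prime S → q ∈ S → product (map pred S) < product S
∏pred<∏ {p ∷ S} (p-prime ∷ S-prime) _ = begin-strict
  pred p * product (map pred S) ≤⟨ *-monoʳ-≤ (pred p) (∏pred≤∏ S) ⟩
  pred p * product S            <⟨ *-monoˡ-< (product S) pred[p]<p ⟩
  p * product S                 ∎
  where
  open ≤-Reasoning
  instance
    ∏S≢0 : NonZero (product S)
    ∏S≢0 = >-nonZero (productOfPrimes≥1 S-prime)
    p≢0 : NonZero p
    p≢0 = prime⇒nonZero p-prime
  pred[p]<p : pred p < p
  pred[p]<p = m≤pred[n]⇒suc[m]≤n ≤-refl

∏pred>0 : ∀ {S} → All Prime S → 0 < product (map pred S)
∏pred>0 []                               = s≤s z≤n
∏pred>0 {zero ∷ S}        (0-prime ∷ _) = contradiction 0-prime ¬prime[0]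
∏pred>0 {suc zero ∷ S}    (1-prime ∷ _) = contradiction 1-prime ¬prime[1]
∏pred>0 {suc (suc k) ∷ S} (_ ∷ S-prime) = *-mono-≤ {1} {suc k} (s≤s z≤n) (∏pred>0 S-prime)

factorProduct : List ℕ → ℚ
factorProduct = foldr (λ p acc → factor p *ℚ acc) 1ℚ

factor-≃ : ∀ k → toℚᵘ (factor (suc (suc k))) ≃ᵘ ℚᵘ.1ℚᵘ ℚᵘ.+ mkℚᵘ (+ 1) k
factor-≃ k = ℚᵘ.≃-trans (ℚ.toℚᵘ-homo-+ 1ℚ ((+ 1) / suc k))
  (ℚᵘ.+-congʳ (toℚᵘ 1ℚ) (ℚ.toℚᵘ-fromℚᵘ (mkℚᵘ (+ 1) k)))

-- Numerator and denominator are kept in the form suc _, on which integer multiplication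
-- computes, so that cross-multiplying is an identity of natural numbers.
factorProduct-≃ : ∀ {S} → All Prime S → ∃₂ λ P′ D′ →
  product S ≡ suc P′ × product (map pred S) ≡ suc D′ ×
  toℚᵘ (factorProduct S) ≃ᵘ mkℚᵘ (+ suc P′) D′
factorProduct-≃ [] = 0 , 0 , refl , refl , ℚᵘ.≃-refl {toℚᵘ 1ℚ}
factorProduct-≃ {zero ∷ S}       (0-prime ∷ _) = contradiction 0-prime ¬prime[0]
factorProduct-≃ {suc zero ∷ S}   (1-prime ∷ _) = contradiction 1-prime ¬prime[1]
factorProduct-≃ {suc (suc k) ∷ S} (_ ∷ S-prime) with factorProduct-≃ S-prime
... | P′ , D′ , P≡ , D≡ , S≃ =
  P′ + suc k * suc P′ , D′ + k * suc D′ , cong (suc (suc k) *_) P≡ , cong (suc k *_) D≡ ,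
  ℚᵘ.≃-trans (ℚ.toℚᵘ-homo-* (factor (suc (suc k))) (factorProduct S))
    (ℚᵘ.≃-trans (ℚᵘ.*-cong (factor-≃ k) S≃)
      (*≡* (cong (λ t → + suc t) (cross-multiplied k P′ D′))))
  where
  cross-multiplied : ∀ k P D → D + k * suc D + (P + (k + 0 + 1) * suc P) * suc (D + k * suc D)
    ≡ D + (k + 0) * suc D + (P + suc (P + k * suc P)) * suc (D + (k + 0) * suc D)
  cross-multiplied = solve-∀

x<factorProduct : ∀ {S} x → All Prime S → x * product (map pred S) < product S →
  ((+ x) / 1) <ℚ factorProduct S
x<factorProduct {S} x S-prime x*D<P with factorProduct-≃ S-prime
... | P′ , D′ , P≡ , D≡ , S≃ = ℚ.toℚᵘ-cancel-<
  (ℚᵘ.<-respˡ-≃ (ℚᵘ.≃-sym (ℚ.toℚᵘ-fromℚᵘ (mkℚᵘ (+ x) 0)))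
    (ℚᵘ.<-respʳ-≃ (ℚᵘ.≃-sym S≃)
      (*<* (subst₂ ℤ._<_ (ℤ.pos-* x (suc D′)) (ℤ.pos-* (suc P′) 1) (ℤ.+<+ x*D<P*1)))))
  where
  x*D<P*1 : x * suc D′ < suc P′ * 1
  x*D<P*1 = subst₂ (λ D P → x * D < P) D≡ (trans P≡ (sym (*-identityʳ (suc P′)))) x*D<P

-- The quotients (x^k − y^k)/(x − y)

geomSum : ℕ → ℕ → ℕ → ℕ
geomSum x y zero    = 0
geomSum x y (suc k) = x * geomSum x y k + y ^ k

geomSum-telescopes : ∀ y e k → y ^ k + e * geomSum (y + e) y k ≡ (y + e) ^ k
geomSum-telescopes y e zero    = cong suc (*-zeroʳ e)
geomSum-telescopes y e (suc k) = begin
  y * y ^ k + e * ((y + e) * G + y ^ k) ≡⟨ regroup y e G (y ^ k) ⟩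
  (y + e) * (y ^ k + e * G)             ≡⟨ cong ((y + e) *_) (geomSum-telescopes y e k) ⟩
  (y + e) * (y + e) ^ k                 ∎
  where
  open ≡-Reasoning
  G : ℕ
  G = geomSum (y + e) y k
  regroup : ∀ y e G Y → y * Y + e * ((y + e) * G + Y) ≡ (y + e) * (Y + e * G)
  regroup = solve-∀

quot≡geomSum : ∀ {x y} k → y < x → quot x y k ≡ geomSum x y k
quot≡geomSum {x} {y} k y<x with x ∸ y in x∸y≡
... | zero  = contradiction (m∸n≡0⇒m≤n x∸y≡) (<⇒≱ y<x)
... | suc d with refl ← trans (sym (m+[n∸m]≡n (<⇒≤ y<x))) (cong (_+_ y) x∸y≡) = begin
  ((y + suc d) ^ k ∸ y ^ k) div suc d
    ≡⟨ cong (λ t → (t ∸ y ^ k) div suc d) (sym (geomSum-telescopes y (suc d) k)) ⟩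
  (y ^ k + suc d * G ∸ y ^ k) div suc d
    ≡⟨ cong (_div suc d) (trans (m+n∸m≡n (y ^ k) _) (*-comm (suc d) G)) ⟩
  (G * suc d) div suc d
    ≡⟨ m*n/n≡m G (suc d) ⟩
  G ∎
  where
  open ≡-Reasoning
  G : ℕ
  G = geomSum (y + suc d) y k

geomSum-step : ∀ {x y} k → 0 < y → x * geomSum x y k < geomSum x y (suc k)
geomSum-step {x} {y} k 0<y = begin-strict
  x * geomSum x y k      ≡⟨ +-identityʳ _ ⟨
  x * geomSum x y k + 0  <⟨ +-monoʳ-< (x * geomSum x y k) (m^n>0 y {{>-nonZero 0<y}} k) ⟩
  geomSum x y (suc k)    ∎
  where open ≤-Reasoning

geomSum[1] : ∀ x y → geomSum x y 1 ≡ 1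
geomSum[1] x y = cong (_+ 1) (*-zeroʳ x)

module _ {x y : ℕ} (0<x : 0 < x) (0<y : 0 < y) where

  geomSum-<-suc : ∀ k → geomSum x y k < geomSum x y (suc k)
  geomSum-<-suc k = ≤-<-trans (m≤n*m (geomSum x y k) x {{>-nonZero 0<x}}) (geomSum-step {x} k 0<y)

  geomSum-mono-≤ : ∀ {k l} → k ≤ l → geomSum x y k ≤ geomSum x y l
  geomSum-mono-≤ {k} {zero}  z≤n = ≤-refl
  geomSum-mono-≤ {k} {suc l} k≤1+l with m≤n⇒m<n∨m≡n k≤1+l
  ... | inj₂ refl      = ≤-refl
  ... | inj₁ (s≤s k≤l) = ≤-trans (geomSum-mono-≤ k≤l) (<⇒≤ (geomSum-<-suc l))

  geomSum-mono-< : ∀ {k l} → k < l → geomSum x y k < geomSum x y l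
  geomSum-mono-< {k} {suc l} (s≤s k≤l) = ≤-<-trans (geomSum-mono-≤ k≤l) (geomSum-<-suc l)

  geomSum>0 : ∀ {k} → 0 < k → 0 < geomSum x y k
  geomSum>0 = geomSum-mono-<

  geomSum≡1⇒k≡1 : ∀ {k} → 0 < k → geomSum x y k ≡ 1 → k ≡ 1
  geomSum≡1⇒k≡1 {suc zero}    _ _    = refl
  geomSum≡1⇒k≡1 {suc (suc k)} _ G≡1 =
    contradiction (subst₂ _<_ (geomSum[1] x y) G≡1 G₁<G) (<-irrefl refl)
    where
    G₁<G : geomSum x y 1 < geomSum x y (suc (suc k))
    G₁<G = geomSum-mono-< {1} {suc (suc k)} (s≤s (s≤s z≤n))

  geomSum-ratio⇒x*D<P : ∀ {m n D P} → 0 < n → 0 < D → D < P →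
    geomSum x y n * P ≡ geomSum x y m * D → x * D < P
  geomSum-ratio⇒x*D<P {m} {n} {D} {P} 0<n 0<D D<P Gn*P≡Gm*D =
    *-cancelˡ-< Gn (x * D) P (begin-strict
      Gn * (x * D)  ≡⟨ x*Gn*D ⟩
      x * Gn * D    <⟨ *-monoˡ-< D {{>-nonZero 0<D}} x*Gn<Gm ⟩
      Gm * D        ≡⟨ Gn*P≡Gm*D ⟨
      Gn * P        ∎)
    where
    open ≤-Reasoning
    Gn : ℕ
    Gn = geomSum x y n
    Gm : ℕ
    Gm = geomSum x y m
    x*Gn*D : Gn * (x * D) ≡ x * Gn * D
    x*Gn*D = trans (sym (*-assoc Gn x D)) (cong (_* D) (*-comm Gn x))
    n<m : n < m
    n<m with m ≤? n
    ... | no m≰n = ≰⇒> m≰n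
    ... | yes m≤n = contradiction Gn*P≡Gm*D (>⇒≢ (begin-strict
      Gm * D  ≤⟨ *-monoˡ-≤ D (geomSum-mono-≤ m≤n) ⟩
      Gn * D  <⟨ *-monoʳ-< Gn {{>-nonZero (geomSum>0 0<n)}} D<P ⟩
      Gn * P  ∎))
    x*Gn<Gm : x * Gn < Gm
    x*Gn<Gm = <-≤-trans (geomSum-step {x} n 0<y) (geomSum-mono-≤ n<m)

  geomSum-solution-trivial : ∀ {z m n} → 0 < m → 0 < n → z * geomSum x y m ≡ 1 →
    φ (z * geomSum x y m) ≡ z * geomSum x y n → z ≡ 1 × m ≡ 1 × n ≡ 1
  geomSum-solution-trivial {z} {m} {n} 0<m 0<n N≡1 φ≡ =
    m*n≡1⇒m≡1 z _ N≡1 ,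
    geomSum≡1⇒k≡1 0<m (m*n≡1⇒n≡1 z _ N≡1) ,
    geomSum≡1⇒k≡1 0<n (m*n≡1⇒n≡1 z _ (trans (sym φ≡) (cong φ N≡1)))

  geomSum-solution⇒x<primeProd : ∀ {z m n} → 0 < z → 0 < m → 0 < n →
    φ (z * geomSum x y m) ≡ z * geomSum x y n → ¬ (z ≡ 1 × m ≡ 1 × n ≡ 1) →
    ((+ x) / 1) <ℚ primeProd (z * geomSum x y m)
  geomSum-solution⇒x<primeProd {z} {m} {n} 0<z 0<m 0<n φ≡ nontrivial with 1 <? z * geomSum x y m
  ... | no N≯1 = contradiction (geomSum-solution-trivial 0<m 0<n N≡1 φ≡) nontrivial
    where
    N≡1 : z * geomSum x y m ≡ 1
    N≡1 = ≤-antisym (≮⇒≥ N≯1) (*-mono-≤ 0<z (geomSum>0 0<m))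
  ... | yes 1<N with ∃-prime-divisor 1<N
  ... | q , q-prime , q∣N = x<factorProduct x S-prime
    (geomSum-ratio⇒x*D<P {m} 0<n (∏pred>0 S-prime) (∏pred<∏ S-prime q∈S)
      (φ[z*a]≡z*b⇒b*∏p≡a*∏[p-1] z (geomSum x y m) (geomSum x y n) φ≡))
    where
    instance
      z≢0 : NonZero z
      z≢0 = >-nonZero 0<z
      Gm≢0 : NonZero (geomSum x y m)
      Gm≢0 = >-nonZero (geomSum>0 0<m)
    S-prime : All Prime (primeDivisors (z * geomSum x y m))
    S-prime = primeDivisors-prime (z * geomSum x y m)
    q∈S : q ∈ primeDivisors (z * geomSum x y m)
    q∈S = ∈-primeDivisors⁺ {{m*n≢0 z (geomSum x y m)}} q-prime q∣N

lemma5 : (x y z m n : ℕ) → 0 < y → y < x → 0 < z → 0 < m → 0 < n →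
    φ (z * quot x y m) ≡ z * quot x y n →
    ¬ (z ≡ 1 × m ≡ 1 × n ≡ 1) →
    z ≤ x ∸ y → gcd m n ≡ 1 →
    ((+ x) / 1) <ℚ primeProd (z * quot x y m)
lemma5 x y z m n 0<y y<x 0<z 0<m 0<n φ≡ nontrivial _ _
  rewrite quot≡geomSum m y<x | quot≡geomSum n y<x =
  geomSum-solution⇒x<primeProd (<-trans 0<y y<x) 0<y 0<z 0<m 0<n φ≡ nontrivial
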